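{- Let $(s,h)$ be a memory state, $q\ge1$ and $i,j\in\{1,\dots,q\}$. There is at most one location $l$ satisfying all of: (1) there are $L_1,L_2\ge0$ with $h^{L_1}(s(x_i))=h^{L_2}(s(x_j))=l$; (2) for all $L_1'<L_1$ and all $L_2'\ge0$, $h^{L_1'}(s(x_i))\neq h^{L_2'}(s(x_j))$; (3) there exist $k\in\{1,\dots,q\}$ and $L\ge0$ with $h^L(l)=s(x_k)$.
   Context: A memory state is a pair $(s,h)$ with $s:\mathrm{PVAR}\to\mathrm{LOC}$ (store; $x_1,x_2,\dots$ are program variables) and $h$ a partial function $\mathrm{LOC}\to\mathrm{LOC}$ with finite domain (heap). $h^0$ is the identity and $h^{n+1}(l)=h(h^n(l))$ when $h^n(l)$ is defined and lies in $\mathrm{dom}(h)$, undefined otherwise; an equation $h^n(l)=l'$ asserts in particular that $h^n(l)$ is defined. In condition (2), $L_1$ refers to the value from condition (1). -}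

module Defs where

open import Data.Nat using (ℕ; zero; suc)
open import Data.Maybe using (Maybe; just; nothing)
open import Data.List using (List)
open import Data.List.Membership.Propositional using (_∈_)
open import Data.Product using (Σ; ∃)
open import Relation.Binary.PropositionalEquality using (_≡_)

LOC : Set
LOC = ℕ

-- Program variables x₁, x₂, … are indexed by positive naturals (index i stands for xᵢ).
PVAR : Set
PVAR = ℕ

Store : Set
Store = PVAR → LOC

record Heap : Set where
  field
    fun    : LOC → Maybe LOC
    domain : List LOC
    finite : ∀ l → (∃ λ l' → fun l ≡ just l') → l ∈ domain
open Heap public

dom : Heap → LOC → Set
dom h l = ∃ λ l' → fun h l ≡ just l'

iter : Heap → ℕ → LOC → Maybe LOC
iter h zero    l = just l
iter h (suc n) l with iter h n l
... | nothing = nothing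
... | just l₁ = fun h l₁

_^_[_]≐_ : Heap → ℕ → LOC → LOC → Set
h ^ n [ l ]≐ l' = iter h n l ≡ just l'

record State : Set where
  constructor ⟨_,_⟩
  field
    store : Store
    heap  : Heap

-- A location satisfying (1) and (2) is the point where the h-path from s(xᵢ) first meets
-- the h-path from s(xⱼ). If two such points were reached after L₁ < L₁' steps, the
-- first would be a meeting point before L₁', contradicting (2) for the second; so
-- L₁ = L₁', and both are h^L₁(s(xᵢ)).
module Submission where

open import Defs
open import Data.Nat using (ℕ; _≤_; _<_)
open import Data.Nat.Properties using (<-cmp)
open import Data.Maybe.Properties using (just-injective)
open import Data.Product using (_×_; _,_; ∃; ∃-syntax)
open import Data.Empty using (⊥-elim)
open import Relation.Binary.Definitions using (tri<; tri≈; tri>)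
open import Relation.Binary.PropositionalEquality using (_≡_; refl; trans; sym)
open import Relation.Nullary using (¬_)

≐-functional : ∀ h n {a l l'} → h ^ n [ a ]≐ l → h ^ n [ a ]≐ l' → l ≡ l'
≐-functional _ _ p p' = just-injective (trans (sym p) p')

FirstMeetingAt : Heap → LOC → LOC → ℕ → LOC → Set
FirstMeetingAt h a b L₁ l =
  (∃[ L₂ ] (h ^ L₁ [ a ]≐ l × h ^ L₂ [ b ]≐ l))
  × (∀ L₁' → L₁' < L₁ → ∀ L₂' → ∀ m → h ^ L₁' [ a ]≐ m → ¬ (h ^ L₂' [ b ]≐ m))

FirstMeeting : Heap → LOC → LOC → LOC → Set
FirstMeeting h a b l = ∃[ L₁ ] FirstMeetingAt h a b L₁ l

firstMeeting-unique : ∀ {h a b l l'} → FirstMeeting h a b l → FirstMeeting h a b l' → l ≡ l'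
firstMeeting-unique (L₁ , (L₂ , a→l , b→l) , first) (L₁' , (L₂' , a→l' , b→l') , first')
  with <-cmp L₁ L₁'
... | tri< L₁<L₁' _ _ = ⊥-elim (first' L₁ L₁<L₁' L₂ _ a→l b→l)
... | tri≈ _ refl _  = ≐-functional _ L₁ a→l a→l'
... | tri> _ _ L₁'<L₁ = ⊥-elim (first L₁' L₁'<L₁ L₂' _ a→l' b→l')

lemma4p2 : (s : Store) (h : Heap) (q : ℕ) → 1 ≤ q →
    (i j : ℕ) → 1 ≤ i → i ≤ q → 1 ≤ j → j ≤ q →
    (l l' : LOC) →
    (∃[ L₁ ] ((∃[ L₂ ] (h ^ L₁ [ s i ]≐ l × h ^ L₂ [ s j ]≐ l))
      × (∀ L₁' → L₁' < L₁ → ∀ L₂' → ∀ m → h ^ L₁' [ s i ]≐ m → ¬ (h ^ L₂' [ s j ]≐ m))))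
    × (∃[ k ] (1 ≤ k × k ≤ q × ∃[ L ] (h ^ L [ l ]≐ s k))) →
    (∃[ L₁ ] ((∃[ L₂ ] (h ^ L₁ [ s i ]≐ l' × h ^ L₂ [ s j ]≐ l'))
      × (∀ L₁' → L₁' < L₁ → ∀ L₂' → ∀ m → h ^ L₁' [ s i ]≐ m → ¬ (h ^ L₂' [ s j ]≐ m))))
    × (∃[ k ] (1 ≤ k × k ≤ q × ∃[ L ] (h ^ L [ l' ]≐ s k))) →
    l ≡ l'
lemma4p2 s h q _ i j _ _ _ _ l l' (meets , _) (meets' , _) = firstMeeting-unique meets meets'
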